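{- Let $S$ be a set of surreals, let $s = \sup^* S$ and $\alpha = \ell(s)$. Then for every surreal $z$: $u < z$ for all $u \in S$ if and only if $s \leq z_{\restriction \alpha}$.
   Context: A surreal is a function $s$ from some ordinal $\ell(s)$ (its length, possibly $0$) to $\{+,-\}$; for $\gamma \geq \ell(s)$, $s(\gamma)$ is called undefined. "$s(\gamma)=t(\gamma)$" means both undefined or both defined and equal. Order: for distinct $s,t$, with $\gamma$ least such that $s(\gamma)\neq t(\gamma)$, $s<t$ iff $s(\gamma)<t(\gamma)$ in the ordering $- < \text{undefined} < +$. For $\gamma \leq \ell(s)$, $s_{\restriction\gamma}$ is the surreal of length $\gamma$ agreeing with $s$ below $\gamma$; for $\gamma > \ell(s)$, $s_{\restriction\gamma}=s$; $s_{\restriction\leq\gamma} := s_{\restriction(\gamma+1)}$. For a surreal $u$ of length $\beta$, $u^\frown +$ is the surreal of length $\beta+1$ extending $u$ with value $+$ at $\beta$. Definition of $\sup^* S$ for a set $S$ of surreals: if $S$ has a maximum $u$, $\sup^* S = u^\frown +$. If $S$ has no maximum, $\sup^* S$ is the surreal $s$ such that, for each ordinal $\gamma$, $s(\gamma)$ is defined iff there is $u \in S$ with $u(\gamma)$ defined such that $u'_{\restriction\leq\gamma} = u_{\restriction\leq\gamma}$ for every $u' \in S$ with $u' \geq u$, and in that case $s(\gamma) = u(\gamma)$ (this is independent of the choice of $u$ and yields a surreal; if $S=\emptyset$ it is the empty sequence). -}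

module Defs where

open import Data.Product using (Σ; ∃; _×_; _,_)
open import Data.Sum using (_⊎_)
open import Relation.Nullary using (¬_)
open import Relation.Unary using (Pred)
open import Relation.Binary.Core using (Rel)
open import Relation.Binary.Definitions using (Tri; tri<; tri≈; tri>)
open import Relation.Binary.Structures using (IsStrictTotalOrder)
open import Relation.Binary.PropositionalEquality using (_≡_; _≢_)
open import Induction.WellFounded using (WellFounded)

-- A well-ordered type: it plays the role of (an initial segment of) the
-- class of ordinals.  Surreals are sign sequences indexed by its elements.
record WellOrder : Set₁ where
  field
    Ord               : Set
    _<_               : Rel Ord _
    isStrictTotalOrder : IsStrictTotalOrder _≡_ _<_
    wellFounded       : WellFounded _<_
  open IsStrictTotalOrder isStrictTotalOrder public using (compare)

data Val : Set where
  neg undef pos : Val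

data _<ᵥ_ : Val → Val → Set where
  neg<undef : neg <ᵥ undef
  neg<pos   : neg <ᵥ pos
  undef<pos : undef <ᵥ pos

module SurrealsOver (W : WellOrder) where
  open WellOrder W

  _≤ₒ_ : Ord → Ord → Set
  a ≤ₒ b = a < b ⊎ a ≡ b

  Seq : Set
  Seq = Ord → Val

  record Surreal : Set where
    constructor mkSurreal
    field
      seq     : Seq
      ℓ       : Ord
      def<ℓ   : ∀ γ → γ < ℓ → seq γ ≢ undef
      undef≥ℓ : ∀ γ → ¬ (γ < ℓ) → seq γ ≡ undef
  open Surreal public

  _<ˢ_ : Seq → Seq → Set
  s <ˢ t = Σ Ord λ γ → (∀ δ → δ < γ → s δ ≡ t δ) × (s γ <ᵥ t γ)

  _≈ˢ_ : Seq → Seq → Set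
  s ≈ˢ t = ∀ γ → s γ ≡ t γ

  _≤ˢ_ : Seq → Seq → Set
  s ≤ˢ t = s <ˢ t ⊎ s ≈ˢ t

  _<ₛ_ : Surreal → Surreal → Set
  s <ₛ t = seq s <ˢ seq t

  _≤ₛ_ : Surreal → Surreal → Set
  s ≤ₛ t = seq s ≤ˢ seq t

  restrictVal : Seq → Ord → Ord → Val
  restrictVal s γ δ with compare δ γ
  ... | tri< _ _ _ = s δ
  ... | tri≈ _ _ _ = undef
  ... | tri> _ _ _ = undef

  _↾_ : Seq → Ord → Seq
  s ↾ γ = restrictVal s γ

  IsSuccPlus : Surreal → Surreal → Set
  IsSuccPlus u t =
    ∀ γ → (γ < ℓ u → seq t γ ≡ seq u γ)
        × (γ ≡ ℓ u → seq t γ ≡ pos)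
        × (ℓ u < γ → seq t γ ≡ undef)

  IsMax : Pred Surreal _ → Surreal → Set
  IsMax S u = S u × (∀ u′ → S u′ → u′ ≤ₛ u)

  Stable : Pred Surreal _ → Ord → Surreal → Set
  Stable S γ u =
    S u × seq u γ ≢ undef
        × (∀ u′ → S u′ → u ≤ₛ u′ → ∀ δ → δ ≤ₒ γ → seq u′ δ ≡ seq u δ)

  -- s = sup* S  (as a relation; it determines s uniquely)
  IsSupStar : Pred Surreal _ → Surreal → Set
  IsSupStar S s =
      (Σ Surreal λ u → IsMax S u × IsSuccPlus u s)
    ⊎ ((¬ ∃ (IsMax S))
       × (∀ γ → ((∃ (Stable S γ)) → seq s γ ≢ undef)
              × (seq s γ ≢ undef → ∃ (Stable S γ))
              × (∀ u → Stable S γ u → seq s γ ≡ seq u γ)))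

{-# OPTIONS --safe #-}
-- Restricting to α compares sequences only below α, so u ↾ α < s ≤ z ↾ α forces u < z, while
-- z ↾ α < s puts z below every member of S that agrees with s up to their first difference.
-- If S has a maximum u, then s = u⁀+ and both directions reduce to comparing z with u at ℓ u.
-- Otherwise every position γ < α = ℓ s is stable: some member of S agrees with s up to γ and
-- nothing in S overtakes it there, so no member of S exceeds s at a position below α.  Nor can a
-- member u agree with s on all of α: s is undefined at α, so u is not stable there and some member
-- above u takes a strictly larger value at α (if u is undefined at α, because S has no maximum);
-- the chain − < undefined < + cannot be climbed forever.  Hence u ↾ α < s for every u ∈ S.
module Submission where

open import Defs
open import Axiom.ExcludedMiddle using (ExcludedMiddle)
open import Level using (0ℓ)
open import Relation.Unary using (Pred)
open import Function.Bundles using (_⇔_; mk⇔)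
open import Function.Properties.Equivalence using () renaming (trans to ⇔-trans)
open import Data.Product using (∃; _×_; _,_; proj₁; proj₂)
open import Data.Sum using (_⊎_; inj₁; inj₂)
open import Data.Empty using (⊥-elim)
open import Relation.Nullary using (¬_; Dec; yes; no)
open import Relation.Nullary.Decidable using (decidable-stable)
open import Relation.Binary.Definitions using (tri<; tri≈; tri>)
open import Relation.Binary.Structures using (IsStrictTotalOrder)
open import Relation.Binary.PropositionalEquality using (_≡_; _≢_; refl; sym; trans; subst; subst₂)
open import Induction.WellFounded using (Acc; acc)

<ᵥ-irrefl : ∀ {v} → ¬ v <ᵥ v
<ᵥ-irrefl ()

<ᵥ⇒≢ : ∀ {v w} → v <ᵥ w → v ≢ w
<ᵥ⇒≢ v<v refl = <ᵥ-irrefl v<v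

<ᵥ-asym : ∀ {v w} → v <ᵥ w → ¬ w <ᵥ v
<ᵥ-asym neg<undef ()
<ᵥ-asym neg<pos ()
<ᵥ-asym undef<pos ()

<ᵥ-trans : ∀ {u v w} → u <ᵥ v → v <ᵥ w → u <ᵥ w
<ᵥ-trans neg<undef undef<pos = neg<pos
<ᵥ-trans neg<pos ()
<ᵥ-trans undef<pos ()

undef<ᵥ⇒≡pos : ∀ {v} → undef <ᵥ v → v ≡ pos
undef<ᵥ⇒≡pos undef<pos = refl

≢⇒<ᵥ⊎>ᵥ : ∀ {v w} → v ≢ w → v <ᵥ w ⊎ w <ᵥ v
≢⇒<ᵥ⊎>ᵥ {neg}   {neg}   v≢w = ⊥-elim (v≢w refl)
≢⇒<ᵥ⊎>ᵥ {neg}   {undef} _   = inj₁ neg<undef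
≢⇒<ᵥ⊎>ᵥ {neg}   {pos}   _   = inj₁ neg<pos
≢⇒<ᵥ⊎>ᵥ {undef} {neg}   _   = inj₂ neg<undef
≢⇒<ᵥ⊎>ᵥ {undef} {undef} v≢w = ⊥-elim (v≢w refl)
≢⇒<ᵥ⊎>ᵥ {undef} {pos}   _   = inj₁ undef<pos
≢⇒<ᵥ⊎>ᵥ {pos}   {neg}   _   = inj₂ neg<pos
≢⇒<ᵥ⊎>ᵥ {pos}   {undef} _   = inj₂ undef<pos
≢⇒<ᵥ⊎>ᵥ {pos}   {pos}   v≢w = ⊥-elim (v≢w refl)

_≟ᵥ_ : (v w : Val) → Dec (v ≡ w)
neg   ≟ᵥ neg   = yes refl
neg   ≟ᵥ undef = no λ ()
neg   ≟ᵥ pos   = no λ ()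
undef ≟ᵥ neg   = no λ ()
undef ≟ᵥ undef = yes refl
undef ≟ᵥ pos   = no λ ()
pos   ≟ᵥ neg   = no λ ()
pos   ≟ᵥ undef = no λ ()
pos   ≟ᵥ pos   = yes refl

module _ {P : Val → Set} (ascend : ∀ {v} → P v → ∃ λ w → v <ᵥ w × P w) where
  private
    ¬P-pos : ¬ P pos
    ¬P-pos p with ascend p
    ... | _ , () , _

    ¬P-undef : ¬ P undef
    ¬P-undef p with ascend p
    ... | pos , _ , q = ¬P-pos q

  ascending-chain-absurd : ∀ v → ¬ P v
  ascending-chain-absurd pos   = ¬P-pos
  ascending-chain-absurd undef = ¬P-undef
  ascending-chain-absurd neg p with ascend p
  ... | undef , _ , q = ¬P-undef q
  ... | pos   , _ , q = ¬P-pos q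

module SequenceOrder (W : WellOrder) where
  open WellOrder W
  open SurrealsOver W
  open IsStrictTotalOrder isStrictTotalOrder using (irrefl; _<?_) renaming (trans to <-trans)

  infix 4 _≈ˢ_below_ _≈ˢ_upTo_ _<ˢ_at_

  _≈ˢ_below_ : Seq → Seq → Ord → Set
  x ≈ˢ y below α = ∀ δ → δ < α → x δ ≡ y δ

  _≈ˢ_upTo_ : Seq → Seq → Ord → Set
  x ≈ˢ y upTo α = ∀ δ → δ ≤ₒ α → x δ ≡ y δ

  _<ˢ_at_ : Seq → Seq → Ord → Set
  x <ˢ y at γ = x ≈ˢ y below γ × x γ <ᵥ y γ

  VanishesFrom : Ord → Seq → Set
  VanishesFrom α x = ∀ δ → ¬ δ < α → x δ ≡ undef

  private variable
    α β γ δ : Ord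
    x y z x′ y′ : Seq

  <-irrefl : ¬ α < α
  <-irrefl = irrefl refl

  <-≮-trans : δ < α → ¬ γ < α → δ < γ
  <-≮-trans {δ} {γ = γ} δ<α γ≮α with compare δ γ
  ... | tri< δ<γ _ _ = δ<γ
  ... | tri≈ _ refl _ = ⊥-elim (γ≮α δ<α)
  ... | tri> _ _ γ<δ = ⊥-elim (γ≮α (<-trans γ<δ δ<α))

  ≈ˢ-below⇒upTo : x ≈ˢ y below α → γ < α → x ≈ˢ y upTo γ
  ≈ˢ-below⇒upTo x≈y γ<α δ (inj₁ δ<γ) = x≈y δ (<-trans δ<γ γ<α)
  ≈ˢ-below⇒upTo x≈y γ<α δ (inj₂ refl) = x≈y δ γ<α

  ≈ˢ-upTo-sym : x ≈ˢ y upTo γ → y ≈ˢ x upTo γ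
  ≈ˢ-upTo-sym x≈y δ δ≤γ = sym (x≈y δ δ≤γ)

  ≈ˢ⇒upTo : x ≈ˢ y → x ≈ˢ y upTo γ
  ≈ˢ⇒upTo x≈y δ _ = x≈y δ

  ≈ˢ-upTo-refl : x ≈ˢ x upTo γ
  ≈ˢ-upTo-refl _ _ = refl

  <ˢ-at-resp : x <ˢ y at γ → x ≈ˢ x′ upTo γ → y ≈ˢ y′ upTo γ → x′ <ˢ y′ at γ
  <ˢ-at-resp {γ = γ} (x≈y , xγ<yγ) x≈x′ y≈y′ =
    (λ δ δ<γ → trans (sym (x≈x′ δ (inj₁ δ<γ))) (trans (x≈y δ δ<γ) (y≈y′ δ (inj₁ δ<γ)))) ,
    subst₂ _<ᵥ_ (x≈x′ γ (inj₂ refl)) (y≈y′ γ (inj₂ refl)) xγ<yγ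

  <ˢ-at-below : VanishesFrom α x → VanishesFrom α y → x <ˢ y at γ → γ < α
  <ˢ-at-below {α} {γ = γ} x-vanishes y-vanishes (_ , xγ<yγ) = decidable-stable (γ <? α) λ γ≮α →
    <ᵥ-irrefl (subst₂ _<ᵥ_ (x-vanishes γ γ≮α) (y-vanishes γ γ≮α) xγ<yγ)

  <ˢ-asym : x <ˢ y → ¬ y <ˢ x
  <ˢ-asym (γ , x<y) (δ , y<x) with compare γ δ
  ... | tri< γ<δ _ _ = <ᵥ⇒≢ (proj₂ x<y) (sym (proj₁ y<x γ γ<δ))
  ... | tri≈ _ refl _ = <ᵥ-asym (proj₂ x<y) (proj₂ y<x)
  ... | tri> _ _ δ<γ = <ᵥ⇒≢ (proj₂ y<x) (sym (proj₁ x<y δ δ<γ))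

  <ˢ-trans : x <ˢ y → y <ˢ z → x <ˢ z
  <ˢ-trans (γ , x<y) (δ , y<z) with compare γ δ
  ... | tri< γ<δ _ _ = γ , <ˢ-at-resp x<y ≈ˢ-upTo-refl (≈ˢ-below⇒upTo (proj₁ y<z) γ<δ)
  ... | tri≈ _ refl _ =
    γ , (λ ε ε<γ → trans (proj₁ x<y ε ε<γ) (proj₁ y<z ε ε<γ)) , <ᵥ-trans (proj₂ x<y) (proj₂ y<z)
  ... | tri> _ _ δ<γ = δ , <ˢ-at-resp y<z (≈ˢ-upTo-sym (≈ˢ-below⇒upTo (proj₁ x<y) δ<γ)) ≈ˢ-upTo-refl

  <ˢ-≤ˢ-trans : x <ˢ y → y ≤ˢ z → x <ˢ z
  <ˢ-≤ˢ-trans x<y (inj₁ y<z) = <ˢ-trans x<y y<z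
  <ˢ-≤ˢ-trans (γ , x<y) (inj₂ y≈z) = γ , <ˢ-at-resp x<y ≈ˢ-upTo-refl (≈ˢ⇒upTo y≈z)

  ≤ˢ-<ˢ-trans : x ≤ˢ y → y <ˢ z → x <ˢ z
  ≤ˢ-<ˢ-trans (inj₁ x<y) y<z = <ˢ-trans x<y y<z
  ≤ˢ-<ˢ-trans (inj₂ x≈y) (γ , y<z) = γ , <ˢ-at-resp y<z (≈ˢ-upTo-sym (≈ˢ⇒upTo x≈y)) ≈ˢ-upTo-refl

  ≤ˢ-first-difference : x ≈ˢ y below α → x ≤ˢ y → x α ≢ y α → x <ˢ y at α
  ≤ˢ-first-difference _ (inj₂ x≈y) xα≢yα = ⊥-elim (xα≢yα (x≈y _))
  ≤ˢ-first-difference {α = α} x≈y (inj₁ (γ , x<y)) xα≢yα with compare γ α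
  ... | tri< γ<α _ _ = ⊥-elim (<ᵥ⇒≢ (proj₂ x<y) (x≈y γ γ<α))
  ... | tri≈ _ refl _ = x<y
  ... | tri> _ _ α<γ = ⊥-elim (xα≢yα (proj₁ x<y α α<γ))

  VanishesFrom-mono : VanishesFrom α x → α < β → VanishesFrom β x
  VanishesFrom-mono x-vanishes α<β δ δ≮β = x-vanishes δ λ δ<α → δ≮β (<-trans δ<α α<β)

  defined⇒<ℓ : (u : Surreal) → seq u γ ≢ undef → γ < ℓ u
  defined⇒<ℓ {γ} u uγ-def = decidable-stable (γ <? ℓ u) λ γ≮ℓ → uγ-def (undef≥ℓ u γ γ≮ℓ)

  undef⇒VanishesFrom : (u : Surreal) → seq u α ≡ undef → VanishesFrom α (seq u)
  undef⇒VanishesFrom {α} u uα δ δ≮α with compare δ α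
  ... | tri< δ<α _ _ = ⊥-elim (δ≮α δ<α)
  ... | tri≈ _ refl _ = uα
  ... | tri> _ _ α<δ = undef≥ℓ u δ λ δ<ℓ → def<ℓ u α (<-trans α<δ δ<ℓ) uα

  ↾-< : δ < α → (x ↾ α) δ ≡ x δ
  ↾-< {δ} {α} δ<α with compare δ α
  ... | tri< _ _ _ = refl
  ... | tri≈ δ≮α _ _ = ⊥-elim (δ≮α δ<α)
  ... | tri> δ≮α _ _ = ⊥-elim (δ≮α δ<α)

  ↾-VanishesFrom : VanishesFrom α (x ↾ α)
  ↾-VanishesFrom {α} δ δ≮α with compare δ α
  ... | tri< δ<α _ _ = ⊥-elim (δ≮α δ<α)
  ... | tri≈ _ _ _ = refl
  ... | tri> _ _ _ = refl

  ↾-≈ˢ-below : x ↾ α ≈ˢ x below α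
  ↾-≈ˢ-below δ = ↾-<

  ↾-id : VanishesFrom α x → (x ↾ α) ≈ˢ x
  ↾-id {α} x-vanishes δ with δ <? α
  ... | yes δ<α = ↾-< δ<α
  ... | no δ≮α = trans (↾-VanishesFrom δ δ≮α) (sym (x-vanishes δ δ≮α))

  <ˢ-from-↾ : (x ↾ α) <ˢ (y ↾ α) → x <ˢ y
  <ˢ-from-↾ (γ , x↾<y↾) =
    γ , <ˢ-at-resp x↾<y↾ (≈ˢ-below⇒upTo ↾-≈ˢ-below γ<α) (≈ˢ-below⇒upTo ↾-≈ˢ-below γ<α)
    where γ<α = <ˢ-at-below ↾-VanishesFrom ↾-VanishesFrom x↾<y↾

  <ˢ-through-↾ : (x ↾ α) <ˢ y → y ≤ˢ (z ↾ α) → x <ˢ z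
  <ˢ-through-↾ x↾<y y≤z↾ = <ˢ-from-↾ (<ˢ-≤ˢ-trans x↾<y y≤z↾)

  module _ (u t : Surreal) (t≡u⁀+ : IsSuccPlus u t) where
    private
      t≈u-below : seq t ≈ˢ seq u below ℓ u
      t≈u-below γ = proj₁ (t≡u⁀+ γ)

      t-at-ℓu : seq t (ℓ u) ≡ pos
      t-at-ℓu = proj₁ (proj₂ (t≡u⁀+ (ℓ u))) refl

      t-above-ℓu : ℓ u < γ → seq t γ ≡ undef
      t-above-ℓu {γ} = proj₂ (proj₂ (t≡u⁀+ γ))

      u-at-ℓu : seq u (ℓ u) ≡ undef
      u-at-ℓu = undef≥ℓ u (ℓ u) <-irrefl

      ℓu<ℓt : ℓ u < ℓ t
      ℓu<ℓt = defined⇒<ℓ t λ tℓu-undef → <ᵥ⇒≢ undef<pos (trans (sym tℓu-undef) t-at-ℓu)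

      above-ℓu⇒≮ℓt : ℓ u < γ → ¬ γ < ℓ t
      above-ℓu⇒≮ℓt {γ} ℓu<γ γ<ℓt = def<ℓ t γ γ<ℓt (t-above-ℓu ℓu<γ)

      u↾<t : (seq u ↾ ℓ t) <ˢ seq t
      u↾<t = ≤ˢ-<ˢ-trans (inj₂ (↾-id (VanishesFrom-mono (undef≥ℓ u) ℓu<ℓt)))
        (ℓ u , (λ δ δ<ℓu → sym (t≈u-below δ δ<ℓu)) , subst₂ _<ᵥ_ (sym u-at-ℓu) (sym t-at-ℓu) undef<pos)

    succPlus-<ₛ⇔ : (z : Surreal) → u <ₛ z ⇔ seq t ≤ˢ (seq z ↾ ℓ t)
    succPlus-<ₛ⇔ z = mk⇔ to (λ t≤z↾ → <ˢ-through-↾ u↾<t t≤z↾)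
      where
      to : u <ₛ z → seq t ≤ˢ (seq z ↾ ℓ t)
      to (γ , u<z) with compare γ (ℓ u)
      ... | tri< γ<ℓu _ _ = inj₁ (γ , <ˢ-at-resp u<z (≈ˢ-upTo-sym (≈ˢ-below⇒upTo t≈u-below γ<ℓu))
                                                     (≈ˢ-upTo-sym (≈ˢ-below⇒upTo ↾-≈ˢ-below (<-trans γ<ℓu ℓu<ℓt))))
      ... | tri> _ _ ℓu<γ = ⊥-elim (<-irrefl (<-trans ℓu<γ γ<ℓu))
        where
        γ<ℓu : γ < ℓ u
        γ<ℓu = <ˢ-at-below (undef≥ℓ u) (undef⇒VanishesFrom z (trans (sym (proj₁ u<z (ℓ u) ℓu<γ)) u-at-ℓu)) u<z
      ... | tri≈ _ refl _ = inj₂ t≈z↾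
        where
        z-at-ℓu : seq z (ℓ u) ≡ pos
        z-at-ℓu = undef<ᵥ⇒≡pos (subst (_<ᵥ seq z (ℓ u)) u-at-ℓu (proj₂ u<z))
        t≈z↾ : seq t ≈ˢ (seq z ↾ ℓ t)
        t≈z↾ δ with compare δ (ℓ u)
        ... | tri< δ<ℓu _ _ =
          trans (t≈u-below δ δ<ℓu) (trans (proj₁ u<z δ δ<ℓu) (sym (↾-< (<-trans δ<ℓu ℓu<ℓt))))
        ... | tri≈ _ refl _ = trans t-at-ℓu (trans (sym z-at-ℓu) (sym (↾-< ℓu<ℓt)))
        ... | tri> _ _ ℓu<δ = trans (t-above-ℓu ℓu<δ) (sym (↾-VanishesFrom δ (above-ℓu⇒≮ℓt ℓu<δ)))

  all<ₛ⇔max<ₛ : {S : Pred Surreal 0ℓ} {u : Surreal} → IsMax S u →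
                (z : Surreal) → (∀ u′ → S u′ → u′ <ₛ z) ⇔ u <ₛ z
  all<ₛ⇔max<ₛ (u∈S , u-max) _ =
    mk⇔ (λ all< → all< _ u∈S) (λ u<z u′ u′∈S → ≤ˢ-<ˢ-trans (u-max u′ u′∈S) u<z)

module Classical (lem : ExcludedMiddle 0ℓ) (W : WellOrder) where
  open WellOrder W
  open SurrealsOver W
  open SequenceOrder W
  open IsStrictTotalOrder isStrictTotalOrder using (_<?_) renaming (trans to <-trans)

  private variable
    γ δ : Ord

  least-satisfying : (P : Ord → Set) → ∀ {γ} → Acc _<_ γ → P γ →
                     ∃ λ μ → P μ × ∀ δ → δ < μ → ¬ P δ
  least-satisfying P {γ} (acc smaller) Pγ with lem {∃ λ δ → δ < γ × P δ}
  ... | yes (δ , δ<γ , Pδ) = least-satisfying P (smaller δ<γ) Pδ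
  ... | no ∄δ = γ , Pγ , λ δ δ<γ Pδ → ∄δ (δ , δ<γ , Pδ)

  <ˢ-trichotomy : (x y : Seq) → x <ˢ y ⊎ x ≈ˢ y ⊎ y <ˢ x
  <ˢ-trichotomy x y with lem {∃ λ γ → x γ ≢ y γ}
  ... | no ∄γ = inj₂ (inj₁ λ γ → decidable-stable (x γ ≟ᵥ y γ) λ xγ≢yγ → ∄γ (γ , xγ≢yγ))
  ... | yes (γ , xγ≢yγ) with least-satisfying (λ γ → x γ ≢ y γ) (wellFounded γ) xγ≢yγ
  ... | μ , xμ≢yμ , agree-below with ≢⇒<ᵥ⊎>ᵥ xμ≢yμ
  ... | inj₁ xμ<yμ = inj₁ (μ , x≈y , xμ<yμ)
    where x≈y = λ δ δ<μ → decidable-stable (x δ ≟ᵥ y δ) (agree-below δ δ<μ)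
  ... | inj₂ yμ<xμ = inj₂ (inj₂ (μ , y≈x , yμ<xμ))
    where y≈x = λ δ δ<μ → sym (decidable-stable (x δ ≟ᵥ y δ) (agree-below δ δ<μ))

  module NoMaximum (S : Pred Surreal 0ℓ) (s : Surreal) (no-max : ¬ ∃ (IsMax S))
    (s≡sup* : ∀ γ → (∃ (Stable S γ) → seq s γ ≢ undef)
                  × (seq s γ ≢ undef → ∃ (Stable S γ))
                  × (∀ u → Stable S γ u → seq s γ ≡ seq u γ)) where

    stable-below-ℓ : γ < ℓ s → ∃ (Stable S γ)
    stable-below-ℓ {γ} γ<ℓ = proj₁ (proj₂ (s≡sup* γ)) (def<ℓ s γ γ<ℓ)

    ¬stable-at-ℓ : ¬ ∃ (Stable S (ℓ s))
    ¬stable-at-ℓ stable = proj₁ (s≡sup* (ℓ s)) stable (undef≥ℓ s (ℓ s) <-irrefl)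

    Stable-≤ : ∀ {v} → Stable S γ v → δ ≤ₒ γ → Stable S δ v
    Stable-≤ (v∈S , vγ-def , v-stable) (inj₂ refl) = v∈S , vγ-def , v-stable
    Stable-≤ {γ} {δ} {v} (v∈S , vγ-def , v-stable) (inj₁ δ<γ) =
      v∈S , def<ℓ v δ (<-trans δ<γ (defined⇒<ℓ v vγ-def)) ,
      λ u′ u′∈S v≤u′ ε ε≤δ → v-stable u′ u′∈S v≤u′ ε (≤ₒ-<-trans ε≤δ)
      where
      ≤ₒ-<-trans : ∀ {ε} → ε ≤ₒ δ → ε ≤ₒ γ
      ≤ₒ-<-trans (inj₁ ε<δ) = inj₁ (<-trans ε<δ δ<γ)
      ≤ₒ-<-trans (inj₂ refl) = inj₁ δ<γ

    Stable⇒≈ˢsup : ∀ {v} → Stable S γ v → seq s ≈ˢ seq v upTo γ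
    Stable⇒≈ˢsup v-stable δ δ≤γ = proj₂ (proj₂ (s≡sup* δ)) _ (Stable-≤ v-stable δ≤γ)

    ¬sup<ˢmember-at : ∀ {u} → S u → γ < ℓ s → ¬ seq s <ˢ seq u at γ
    ¬sup<ˢmember-at {γ} {u} u∈S γ<ℓ s<u with stable-below-ℓ γ<ℓ
    ... | v , v-stable@(_ , _ , v-unsurpassed) =
      <ᵥ⇒≢ (proj₂ v<u) (sym (v-unsurpassed u u∈S (inj₁ (γ , v<u)) γ (inj₂ refl)))
      where
      v<u : seq v <ˢ seq u at γ
      v<u = <ˢ-at-resp s<u (Stable⇒≈ˢsup v-stable) ≈ˢ-upTo-refl

    exists-greater-member : ∀ {u} → S u → ∃ λ u′ → S u′ × u <ₛ u′
    exists-greater-member {u} u∈S with lem {∃ λ u′ → S u′ × u <ₛ u′}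
    ... | yes greater = greater
    ... | no ∄greater = ⊥-elim (no-max (u , u∈S , λ u′ u′∈S → ≤u u′ u′∈S))
      where
      ≤u : ∀ u′ → S u′ → u′ ≤ₛ u
      ≤u u′ u′∈S with <ˢ-trichotomy (seq u) (seq u′)
      ... | inj₁ u<u′ = ⊥-elim (∄greater (u′ , u′∈S , u<u′))
      ... | inj₂ (inj₁ u≈u′) = inj₂ λ γ → sym (u≈u′ γ)
      ... | inj₂ (inj₂ u′<u) = inj₁ u′<u

    Agrees : Surreal → Set
    Agrees u = seq u ≈ˢ seq s below ℓ s

    Agrees-upward : ∀ u {u′} → S u′ → Agrees u → u ≤ₛ u′ → Agrees u′
    Agrees-upward _ _ u-agrees (inj₂ u≈u′) δ δ<ℓ = trans (sym (u≈u′ δ)) (u-agrees δ δ<ℓ)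
    Agrees-upward _ u′∈S u-agrees (inj₁ (γ , u<u′)) with γ <? ℓ s
    ... | yes γ<ℓ = ⊥-elim (¬sup<ˢmember-at u′∈S γ<ℓ
                      (<ˢ-at-resp u<u′ (≈ˢ-below⇒upTo u-agrees γ<ℓ) ≈ˢ-upTo-refl))
    ... | no γ≮ℓ = λ δ δ<ℓ → trans (sym (proj₁ u<u′ δ (<-≮-trans δ<ℓ γ≮ℓ))) (u-agrees δ δ<ℓ)

    changes-at-ℓ : ∀ {u} → S u → Agrees u →
                   ∃ λ u′ → S u′ × u ≤ₛ u′ × seq u′ (ℓ s) ≢ seq u (ℓ s)
    changes-at-ℓ {u} u∈S u-agrees with lem {∃ λ u′ → S u′ × u ≤ₛ u′ × seq u′ (ℓ s) ≢ seq u (ℓ s)}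
    ... | yes change = change
    ... | no ∄change with seq u (ℓ s) ≟ᵥ undef
    ...   | no uℓ-def = ⊥-elim (¬stable-at-ℓ (u , u∈S , uℓ-def , u-stable))
      where
      u-stable : ∀ u′ → S u′ → u ≤ₛ u′ → seq u′ ≈ˢ seq u upTo ℓ s
      u-stable u′ u′∈S u≤u′ δ (inj₁ δ<ℓ) =
        trans (Agrees-upward u u′∈S u-agrees u≤u′ δ δ<ℓ) (sym (u-agrees δ δ<ℓ))
      u-stable u′ u′∈S u≤u′ δ (inj₂ refl) =
        decidable-stable (seq u′ δ ≟ᵥ seq u δ) λ u′ℓ≢uℓ → ∄change (u′ , u′∈S , u≤u′ , u′ℓ≢uℓ)
    ...   | yes uℓ-undef with exists-greater-member u∈S
    ...     | u′ , u′∈S , (γ , u<u′) = ⊥-elim (∄change (u′ , u′∈S , inj₁ (γ , u<u′) , u′ℓ≢uℓ))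
      where
      u′ℓ≢uℓ : seq u′ (ℓ s) ≢ seq u (ℓ s)
      u′ℓ≢uℓ u′ℓ≡uℓ = <ᵥ⇒≢ (proj₂ u<u′)
        (trans (u-agrees γ γ<ℓ) (sym (Agrees-upward u u′∈S u-agrees (inj₁ (γ , u<u′)) γ γ<ℓ)))
        where
        γ<ℓ : γ < ℓ s
        γ<ℓ = <ˢ-at-below (undef⇒VanishesFrom u uℓ-undef)
                          (undef⇒VanishesFrom u′ (trans u′ℓ≡uℓ uℓ-undef)) u<u′

    AgreeingValueAtℓ : Val → Set
    AgreeingValueAtℓ v = ∃ λ u → S u × Agrees u × seq u (ℓ s) ≡ v

    climbs-at-ℓ : ∀ {v} → AgreeingValueAtℓ v → ∃ λ w → v <ᵥ w × AgreeingValueAtℓ w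
    climbs-at-ℓ (u , u∈S , u-agrees , refl) with changes-at-ℓ u∈S u-agrees
    ... | u′ , u′∈S , u≤u′ , u′ℓ≢uℓ =
      seq u′ (ℓ s) , proj₂ u<u′-at-ℓ , u′ , u′∈S , u′-agrees , refl
      where
      u′-agrees : Agrees u′
      u′-agrees = Agrees-upward u u′∈S u-agrees u≤u′
      u<u′-at-ℓ : seq u <ˢ seq u′ at ℓ s
      u<u′-at-ℓ = ≤ˢ-first-difference (λ δ δ<ℓ → trans (u-agrees δ δ<ℓ) (sym (u′-agrees δ δ<ℓ)))
                                      u≤u′ (λ uℓ≡u′ℓ → u′ℓ≢uℓ (sym uℓ≡u′ℓ))

    ¬Agrees : ∀ {u} → S u → ¬ Agrees u
    ¬Agrees {u} u∈S u-agrees = ascending-chain-absurd climbs-at-ℓ (seq u (ℓ s)) (u , u∈S , u-agrees , refl)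

    member↾<ˢsup : ∀ {u} → S u → (seq u ↾ ℓ s) <ˢ seq s
    member↾<ˢsup {u} u∈S with <ˢ-trichotomy (seq u ↾ ℓ s) (seq s)
    ... | inj₁ u↾<s = u↾<s
    ... | inj₂ (inj₁ u↾≈s) = ⊥-elim (¬Agrees u∈S λ δ δ<ℓ → trans (sym (↾-< δ<ℓ)) (u↾≈s δ))
    ... | inj₂ (inj₂ (γ , s<u↾)) = ⊥-elim (¬sup<ˢmember-at u∈S γ<ℓ
                                    (<ˢ-at-resp s<u↾ ≈ˢ-upTo-refl (≈ˢ-below⇒upTo ↾-≈ˢ-below γ<ℓ)))
      where γ<ℓ = <ˢ-at-below (undef≥ℓ s) ↾-VanishesFrom s<u↾

    all<ₛ⇒¬↾<ˢsup : ∀ z → (∀ u → S u → u <ₛ z) → ¬ (seq z ↾ ℓ s) <ˢ seq s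
    all<ₛ⇒¬↾<ˢsup z all< (γ , z↾<s) = <ˢ-asym (γ , z<v) (all< v (proj₁ v-stable))
      where
      γ<ℓ : γ < ℓ s
      γ<ℓ = <ˢ-at-below ↾-VanishesFrom (undef≥ℓ s) z↾<s
      v : Surreal
      v = proj₁ (stable-below-ℓ γ<ℓ)
      v-stable : Stable S γ v
      v-stable = proj₂ (stable-below-ℓ γ<ℓ)
      z<v : seq z <ˢ seq v at γ
      z<v = <ˢ-at-resp z↾<s (≈ˢ-below⇒upTo ↾-≈ˢ-below γ<ℓ) (Stable⇒≈ˢsup v-stable)

    all<ₛ⇔sup≤ˢ↾ : (z : Surreal) → (∀ u → S u → u <ₛ z) ⇔ seq s ≤ˢ (seq z ↾ ℓ s)
    all<ₛ⇔sup≤ˢ↾ z = mk⇔ to λ s≤z↾ u u∈S → <ˢ-through-↾ (member↾<ˢsup u∈S) s≤z↾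
      where
      to : (∀ u → S u → u <ₛ z) → seq s ≤ˢ (seq z ↾ ℓ s)
      to all< with <ˢ-trichotomy (seq s) (seq z ↾ ℓ s)
      ... | inj₁ s<z↾ = inj₁ s<z↾
      ... | inj₂ (inj₁ s≈z↾) = inj₂ s≈z↾
      ... | inj₂ (inj₂ z↾<s) = ⊥-elim (all<ₛ⇒¬↾<ˢsup z all< z↾<s)

theorem4p3 : ExcludedMiddle 0ℓ → (W : WellOrder) →
    let open SurrealsOver W in
    (S : Pred Surreal 0ℓ) (s : Surreal) → IsSupStar S s →
    (z : Surreal) →
    ((∀ u → S u → u <ₛ z) ⇔ (seq s ≤ˢ (seq z ↾ ℓ s)))
theorem4p3 lem W S s (inj₁ (u , u-max , s≡u⁀+)) z =
  ⇔-trans (all<ₛ⇔max<ₛ u-max z) (succPlus-<ₛ⇔ u s s≡u⁀+ z)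
  where open SequenceOrder W
theorem4p3 lem W S s (inj₂ (no-max , s≡sup*)) z = all<ₛ⇔sup≤ˢ↾ z
  where open Classical.NoMaximum lem W S s no-max s≡sup*
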